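{- Let $\mathbf{M}=(M;\leq,0,1)$ be a non-trivial complete lattice, let $S$ be a non-empty set, and let $\mathbf{A}$ be a bounded subposet of $\mathbf{M}^{S}$. Let $(\wp(S\times S);\subseteq)$ be the poset of all relations on $S$, and let $\mathrm{Map}_0(\mathbf{A},\mathbf{M}^S)$ be the set of all order-preserving mappings $P\colon A\to M^S$ with $P(0)=0$, ordered by $P_1\leq P_2$ if and only if $P_1(a)\leq P_2(a)$ for all $a\in A$. Define $\Phi(R)=P_R$ for $R\in\wp(S\times S)$ and $\Psi(P)=R^{P}$ for $P\in\mathrm{Map}_0(\mathbf{A},\mathbf{M}^S)$. Then $(\Phi,\Psi)$ is a Galois connection between $(\wp(S\times S);\subseteq)$ and $(\mathrm{Map}_0(\mathbf{A},\mathbf{M}^S);\leq)$, i.e., $\Phi$ and $\Psi$ are maps between these posets and for all $R$ and $P$: $\Phi(R)\leq P$ if and only if $R\subseteq \Psi(P)$.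
   Context: Non-trivial means $0\neq 1$. $\mathbf{M}^S$ is ordered componentwise; a bounded subposet of $\mathbf{M}^S$ is a subset containing the constant tuples $0$ and $1$ with the inherited order. For $s\in S$ and $m\in M^S$, $s(m)$ denotes the $s$-th component of $m$. For $R\subseteq S\times S$ (writing $sRt$ for $(s,t)\in R$), $P_R\colon A\to M^S$ is defined by $P_R(a)(t)=\bigvee_M\{s(a)\mid sRt\}$ (the empty join being $0$). For $P\colon A\to M^S$, $R^{P}=\{(s,t)\in S\times S\mid \forall a\in A:\ s(a)\leq t(P(a))\}$. -}

module Defs where

open import Level using (Level; _⊔_; suc)
open import Data.Product using (Σ; _,_; proj₁; proj₂; _×_)
open import Relation.Binary.Bundles using (Poset)
open import Relation.Binary.Core using (Rel)
open import Relation.Nullary using (¬_)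
open import Function.Bundles using (_⇔_)

-- A complete lattice: a poset with a least element 0, a greatest element 1,
-- and a supremum for every family indexed by a type of level ℓ
-- (all universe levels are identified with a single ℓ).
record CompleteLattice (ℓ : Level) : Set (suc ℓ) where
  field
    poset : Poset ℓ ℓ ℓ
  open Poset poset public
  field
    𝟘 : Carrier
    𝟙 : Carrier
    𝟘-least : ∀ x → 𝟘 ≤ x
    𝟙-greatest : ∀ x → x ≤ 𝟙
    ⨆ : {I : Set ℓ} → (I → Carrier) → Carrier
    ⨆-upper : {I : Set ℓ} (f : I → Carrier) (k : I) → f k ≤ ⨆ f
    ⨆-least : {I : Set ℓ} (f : I → Carrier) (y : Carrier) →
              (∀ k → f k ≤ y) → ⨆ f ≤ y

module _ {ℓ : Level} (𝐌 : CompleteLattice ℓ) where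
  open CompleteLattice 𝐌

  NonTrivial : Set ℓ
  NonTrivial = ¬ (𝟘 ≈ 𝟙)

  module _ (S : Set ℓ) where

    _≤ˢ_ : (S → Carrier) → (S → Carrier) → Set ℓ
    m ≤ˢ n = ∀ s → m s ≤ n s

    _≈ˢ_ : (S → Carrier) → (S → Carrier) → Set ℓ
    m ≈ˢ n = ∀ s → m s ≈ n s

    0ˢ 1ˢ : S → Carrier
    0ˢ _ = 𝟘
    1ˢ _ = 𝟙

    record BoundedSubposet : Set (suc ℓ) where
      field
        In : (S → Carrier) → Set ℓ
        0∈ : In 0ˢ
        1∈ : In 1ˢ
      Elt : Set ℓ
      Elt = Σ (S → Carrier) In
      ⟦_⟧ : Elt → S → Carrier
      ⟦_⟧ = proj₁
      zero : Elt
      zero = 0ˢ , 0∈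

    module _ (𝐀 : BoundedSubposet) where
      open BoundedSubposet 𝐀

      record IsMap₀ (map : Elt → S → Carrier) : Set ℓ where
        field
          monotone : ∀ x y → ⟦ x ⟧ ≤ˢ ⟦ y ⟧ → map x ≤ˢ map y
          zero↦zero : map zero ≈ˢ 0ˢ

      Map₀ : Set ℓ
      Map₀ = Σ (Elt → S → Carrier) IsMap₀

      _≤ᴹ_ : (Elt → S → Carrier) → (Elt → S → Carrier) → Set ℓ
      P₁ ≤ᴹ P₂ = ∀ x → P₁ x ≤ˢ P₂ x

      _⊆ᴿ_ : Rel S ℓ → Rel S ℓ → Set ℓ
      R ⊆ᴿ R' = ∀ s t → R s t → R' s t

      P[_] : Rel S ℓ → Elt → S → Carrier
      P[ R ] x t = ⨆ {Σ S (λ s → R s t)} (λ p → ⟦ x ⟧ (proj₁ p))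

      R^ : (Elt → S → Carrier) → Rel S ℓ
      R^ P s t = ∀ x → ⟦ x ⟧ s ≤ P x t

-- Two facts about suprema in a complete lattice carry the argument:
-- ⨆ is monotone in the family, and the supremum of a family of 𝟘s is 𝟘.
-- From them, P_R(a)(t) = ⋁ { s(a) | s R t } is order preserving in a and
-- sends the bottom tuple 0 to 0, so Φ(R) = P_R lands in Map₀(A, M^S).
-- The Galois property Φ(R) ≤ P ⇔ R ⊆ Ψ(P) is the universal property of
-- the supremum read componentwise: P_R(a)(t) ≤ P(a)(t) holds exactly when
-- every s(a) with s R t lies below P(a)(t), i.e. when every such pair
-- (s,t) belongs to R^P.  This equivalence holds for an arbitrary map
-- P : A → M^S.
module Submission where

open import Defs
open import Level using (Level)
open import Data.Product using (_×_; proj₁; _,_; Σ)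
open import Function.Bundles using (_⇔_; mk⇔)
open import Relation.Binary.Core using (Rel)

module Suprema {ℓ : Level} (𝐌 : CompleteLattice ℓ) where
  open CompleteLattice 𝐌

  ⨆-mono : {I : Set ℓ} (f g : I → Carrier) →
           (∀ k → f k ≤ g k) → ⨆ f ≤ ⨆ g
  ⨆-mono f g f≤g = ⨆-least f (⨆ g) (λ k → trans (f≤g k) (⨆-upper g k))

  ⨆-𝟘 : {I : Set ℓ} (f : I → Carrier) → (∀ k → f k ≤ 𝟘) → ⨆ f ≈ 𝟘
  ⨆-𝟘 f f≤𝟘 = antisym (⨆-least f 𝟘 f≤𝟘) (𝟘-least (⨆ f))

module GaloisConnection {ℓ : Level} (𝐌 : CompleteLattice ℓ) (S : Set ℓ)
                        (𝐀 : BoundedSubposet 𝐌 S) where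
  open CompleteLattice 𝐌
  open BoundedSubposet 𝐀
  open Suprema 𝐌

  column : (R : Rel S ℓ) → Elt → (t : S) → Σ S (λ s → R s t) → Carrier
  column R x t (s , _) = ⟦ x ⟧ s

  P[R]-monotone : (R : Rel S ℓ) (x y : Elt) →
                  _≤ˢ_ 𝐌 S ⟦ x ⟧ ⟦ y ⟧ → _≤ˢ_ 𝐌 S (P[_] 𝐌 S 𝐀 R x) (P[_] 𝐌 S 𝐀 R y)
  P[R]-monotone R x y x≤y t =
    ⨆-mono (column R x t) (column R y t) (λ (s , _) → x≤y s)

  P[R]-zero : (R : Rel S ℓ) → _≈ˢ_ 𝐌 S (P[_] 𝐌 S 𝐀 R zero) (0ˢ 𝐌 S)
  P[R]-zero R t = ⨆-𝟘 (column R zero t) (λ _ → refl)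

  P[R]-isMap₀ : (R : Rel S ℓ) → IsMap₀ 𝐌 S 𝐀 (P[_] 𝐌 S 𝐀 R)
  P[R]-isMap₀ R = record
    { monotone  = P[R]-monotone R
    ; zero↦zero = P[R]-zero R
    }

  below⇒⊆R^ : (R : Rel S ℓ) (P : Elt → S → Carrier) →
              _≤ᴹ_ 𝐌 S 𝐀 (P[_] 𝐌 S 𝐀 R) P → _⊆ᴿ_ 𝐌 S 𝐀 R (R^ 𝐌 S 𝐀 P)
  below⇒⊆R^ R P P[R]≤P s t sRt x =
    trans (⨆-upper (column R x t) (s , sRt)) (P[R]≤P x t)

  ⊆R^⇒below : (R : Rel S ℓ) (P : Elt → S → Carrier) →
              _⊆ᴿ_ 𝐌 S 𝐀 R (R^ 𝐌 S 𝐀 P) → _≤ᴹ_ 𝐌 S 𝐀 (P[_] 𝐌 S 𝐀 R) P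
  ⊆R^⇒below R P R⊆R^P x t =
    ⨆-least (column R x t) (P x t) (λ (s , sRt) → R⊆R^P s t sRt x)

  galois : (R : Rel S ℓ) (P : Elt → S → Carrier) →
           _≤ᴹ_ 𝐌 S 𝐀 (P[_] 𝐌 S 𝐀 R) P ⇔ _⊆ᴿ_ 𝐌 S 𝐀 R (R^ 𝐌 S 𝐀 P)
  galois R P = mk⇔ (below⇒⊆R^ R P) (⊆R^⇒below R P)

theorem2p4 : {ℓ : Level} (𝐌 : CompleteLattice ℓ) → NonTrivial 𝐌 →
    (S : Set ℓ) → S → (𝐀 : BoundedSubposet 𝐌 S) →
    ((R : Rel S ℓ) → IsMap₀ 𝐌 S 𝐀 (P[_] 𝐌 S 𝐀 R))
    × ((R : Rel S ℓ) (P : Map₀ 𝐌 S 𝐀) →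
        (_≤ᴹ_ 𝐌 S 𝐀 (P[_] 𝐌 S 𝐀 R) (proj₁ P)) ⇔ (_⊆ᴿ_ 𝐌 S 𝐀 R (R^ 𝐌 S 𝐀 (proj₁ P))))
theorem2p4 𝐌 _ S _ 𝐀 = P[R]-isMap₀ , λ R P → galois R (proj₁ P)
  where open GaloisConnection 𝐌 S 𝐀
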